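{- Let $G=(V,E)$ be a connected graph of order $n$ and let $k\geq 1$. Then $$\max\{\gamma_k(G),\dim(G)\}\leq \gamma^r_k(G)\leq \min\{\gamma_k(G)+\dim(G),\, n-1\}.$$
   Context: For a graph $G=(V,E)$, $d_G(u,v)$ denotes the distance between $u$ and $v$. For $k\geq 1$, a set $D\subseteq V$ is a distance $k$-dominating set if every vertex $v\in V\setminus D$ satisfies $d_G(v,D)=\min\{d_G(v,x):x\in D\}\leq k$; $\gamma_k(G)$ is the minimum cardinality of such a set. For an ordered set $W=\{w_1,\dots,w_r\}\subseteq V$, the metric representation of $v$ is $c(v|W)=(d_G(v,w_1),\dots,d_G(v,w_r))$; $W$ is a resolving set if $c(u|W)\neq c(v|W)$ for all distinct $u,v\in V\setminus W$; $\dim(G)$ (the metric dimension) is the minimum cardinality of a resolving set. A distance $k$-resolving dominating set is a set that is both a resolving set and a distance $k$-dominating set; $\gamma^r_k(G)$ is the minimum cardinality of such a set. -}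

module Defs where

open import Data.Nat using (ℕ; zero; suc; _≤_)
open import Data.Fin using (Fin)
open import Data.Fin.Subset using (Subset; _∈_; _∉_; ∣_∣)
open import Data.Product using (Σ; ∃; ∃-syntax; _×_)
open import Relation.Nullary using (¬_)
open import Relation.Binary.PropositionalEquality using (_≡_; _≢_)

record Graph (n : ℕ) : Set₁ where
  field
    Adj      : Fin n → Fin n → Set
    Adj-sym  : ∀ {u v} → Adj u v → Adj v u
    Adj-irr  : ∀ {u} → ¬ Adj u u

open Graph public

data Walk {n : ℕ} (G : Graph n) : Fin n → Fin n → ℕ → Set where
  nil  : ∀ {u} → Walk G u u 0
  cons : ∀ {u v w m} → Adj G u v → Walk G v w m → Walk G u w (suc m)

Dist : ∀ {n} → Graph n → Fin n → Fin n → ℕ → Set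
Dist G u v m = Walk G u v m × (∀ m′ → Walk G u v m′ → m ≤ m′)

Connected : ∀ {n} → Graph n → Set
Connected G = ∀ u v → ∃[ m ] Walk G u v m

IsDistKDominating : ∀ {n} → Graph n → ℕ → Subset n → Set
IsDistKDominating G k D =
  ∀ v → v ∉ D → ∃[ x ] (x ∈ D × ∃[ m ] (Dist G v x m × m ≤ k))

IsResolving : ∀ {n} → Graph n → Subset n → Set
IsResolving G W =
  ∀ u v → u ∉ W → v ∉ W → u ≢ v →
  ∃[ w ] (w ∈ W × ∃[ a ] ∃[ b ] (Dist G u w a × Dist G v w b × a ≢ b))

IsDistKResolvingDominating : ∀ {n} → Graph n → ℕ → Subset n → Set
IsDistKResolvingDominating G k S = IsResolving G S × IsDistKDominating G k S

IsMinCard : ∀ {n} → (Subset n → Set) → ℕ → Set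
IsMinCard P m = (∃[ S ] (P S × ∣ S ∣ ≡ m)) × (∀ S → P S → m ≤ ∣ S ∣)

IsDomNum : ∀ {n} → Graph n → ℕ → ℕ → Set
IsDomNum G k = IsMinCard (IsDistKDominating G k)

IsMetricDim : ∀ {n} → Graph n → ℕ → Set
IsMetricDim G = IsMinCard (IsResolving G)

IsResDomNum : ∀ {n} → Graph n → ℕ → ℕ → Set
IsResDomNum G k = IsMinCard (IsDistKResolvingDominating G k)

{-# OPTIONS --safe #-}
module Submission where

-- A distance k-resolving dominating set is both distance k-dominating and
-- resolving, which gives the lower bounds. Conversely, the union of a
-- minimum distance k-dominating set and a minimum resolving set is
-- resolving dominating, and so is V ∖ {x}: no two vertices lie outside
-- it, and x has a neighbour in it since G is connected with n ≥ 2.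

open import Defs
open import Data.Empty using (⊥-elim)
open import Data.Fin using (Fin; zero; suc)
open import Data.Fin.Subset using (Subset; inside; outside; _∉_; _⊆_; _∪_; ∁; ⁅_⁆; ∣_∣)
open import Data.Fin.Subset.Properties
  using (p⊆p∪q; q⊆p∪q; x∈⁅y⁆⇒x≡y; x≢y⇒x∉⁅y⁆; x∉∁p⇒x∈p; x∉p⇒x∈∁p; ∣∁p∣≡n∸∣p∣; ∣⁅x⁆∣≡1)
open import Data.Nat using (ℕ; suc; _≤_; _⊔_; _⊓_; _+_; _∸_; s≤s; z≤n)
open import Data.Nat.Properties
  using (≤-trans; ≤-reflexive; n≤1+n; +-suc; +-monoʳ-≤; ⊔-lub; ⊓-glb; module ≤-Reasoning)
open import Data.Product using (_×_; _,_; proj₁; proj₂; ∃-syntax)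
open import Data.Vec using (_∷_; [])
open import Function using (_∘_)
open import Relation.Binary.PropositionalEquality using (_≡_; _≢_; refl; sym; trans; cong; cong₂; subst; ≢-sym)

∣p∪q∣≤∣p∣+∣q∣ : ∀ {n} (p q : Subset n) → ∣ p ∪ q ∣ ≤ ∣ p ∣ + ∣ q ∣
∣p∪q∣≤∣p∣+∣q∣ []            []            = z≤n
∣p∪q∣≤∣p∣+∣q∣ (inside  ∷ p) (inside  ∷ q) =
  s≤s (≤-trans (∣p∪q∣≤∣p∣+∣q∣ p q) (+-monoʳ-≤ ∣ p ∣ (n≤1+n ∣ q ∣)))
∣p∪q∣≤∣p∣+∣q∣ (inside  ∷ p) (outside ∷ q) = s≤s (∣p∪q∣≤∣p∣+∣q∣ p q)
∣p∪q∣≤∣p∣+∣q∣ (outside ∷ p) (inside  ∷ q) =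
  ≤-trans (s≤s (∣p∪q∣≤∣p∣+∣q∣ p q)) (≤-reflexive (sym (+-suc ∣ p ∣ ∣ q ∣)))
∣p∪q∣≤∣p∣+∣q∣ (outside ∷ p) (outside ∷ q) = ∣p∪q∣≤∣p∣+∣q∣ p q

∣∁⁅x⁆∣≡n∸1 : ∀ {n} (x : Fin n) → ∣ ∁ ⁅ x ⁆ ∣ ≡ n ∸ 1
∣∁⁅x⁆∣≡n∸1 {n} x = trans (∣∁p∣≡n∸∣p∣ ⁅ x ⁆) (cong (n ∸_) (∣⁅x⁆∣≡1 x))

x∉∁⁅y⁆⇒x≡y : ∀ {n} {x y : Fin n} → x ∉ ∁ ⁅ y ⁆ → x ≡ y
x∉∁⁅y⁆⇒x≡y {y = y} = x∈⁅y⁆⇒x≡y y ∘ x∉∁p⇒x∈p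

IsMinCard-mono : ∀ {n} {P Q : Subset n → Set} {p q} →
  (∀ {S} → Q S → P S) → IsMinCard P p → IsMinCard Q q → p ≤ q
IsMinCard-mono Q⇒P (_ , minP) ((S , QS , ∣S∣≡q) , _) = subst (_ ≤_) ∣S∣≡q (minP S (Q⇒P QS))

module _ {n} (G : Graph n) where

  Adj⇒Dist1 : ∀ {u v} → Adj G u v → Dist G u v 1
  Adj⇒Dist1 u~v = cons u~v nil , λ where
    .0 nil        → ⊥-elim (Adj-irr G u~v)
    _  (cons _ _) → s≤s z≤n

  Adj⇒≢ : ∀ {u v} → Adj G u v → u ≢ v
  Adj⇒≢ u~u refl = Adj-irr G u~u

  Walk⇒neighbour : ∀ {u v m} → Walk G u v m → u ≢ v → ∃[ y ] Adj G u y
  Walk⇒neighbour nil          u≢u = ⊥-elim (u≢u refl)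
  Walk⇒neighbour (cons u~y _) _   = _ , u~y

  IsResolving-⊆ : ∀ {W W′} → W ⊆ W′ → IsResolving G W → IsResolving G W′
  IsResolving-⊆ W⊆W′ resW u v u∉W′ v∉W′ u≢v
    with w , w∈W , dists ← resW u v (u∉W′ ∘ W⊆W′) (v∉W′ ∘ W⊆W′) u≢v
    = w , W⊆W′ w∈W , dists

  IsDistKDominating-⊆ : ∀ {k D D′} → D ⊆ D′ → IsDistKDominating G k D → IsDistKDominating G k D′
  IsDistKDominating-⊆ D⊆D′ domD v v∉D′
    with x , x∈D , dist ← domD v (v∉D′ ∘ D⊆D′)
    = x , D⊆D′ x∈D , dist

  IsDistKResolvingDominating-∪ : ∀ {k D W} → IsDistKDominating G k D → IsResolving G W →
    IsDistKResolvingDominating G k (D ∪ W)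
  IsDistKResolvingDominating-∪ {D = D} {W} domD resW =
    IsResolving-⊆ (q⊆p∪q D W) resW , IsDistKDominating-⊆ (p⊆p∪q W) domD

  ∁⁅x⁆-resolving : ∀ x → IsResolving G (∁ ⁅ x ⁆)
  ∁⁅x⁆-resolving x u v u∉ v∉ u≢v = ⊥-elim (u≢v (trans (x∉∁⁅y⁆⇒x≡y u∉) (sym (x∉∁⁅y⁆⇒x≡y v∉))))

  ∁⁅x⁆-dominating : ∀ {k x y} → 1 ≤ k → Adj G x y → IsDistKDominating G k (∁ ⁅ x ⁆)
  ∁⁅x⁆-dominating {y = y} 1≤k x~y v v∉ with refl ← x∉∁⁅y⁆⇒x≡y v∉ =
    y , x∉p⇒x∈∁p (x≢y⇒x∉⁅y⁆ (≢-sym (Adj⇒≢ x~y))) , 1 , Adj⇒Dist1 x~y , 1≤k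

  resDomNum≤domNum+metricDim : ∀ {k γk d γr} →
    IsDomNum G k γk → IsMetricDim G d → IsResDomNum G k γr → γr ≤ γk + d
  resDomNum≤domNum+metricDim ((D , domD , ∣D∣≡γk) , _) ((W , resW , ∣W∣≡d) , _) (_ , minR) = begin
    _              ≤⟨ minR (D ∪ W) (IsDistKResolvingDominating-∪ domD resW) ⟩
    ∣ D ∪ W ∣      ≤⟨ ∣p∪q∣≤∣p∣+∣q∣ D W ⟩
    ∣ D ∣ + ∣ W ∣  ≡⟨ cong₂ _+_ ∣D∣≡γk ∣W∣≡d ⟩
    _              ∎
    where open ≤-Reasoning

  resDomNum≤n∸1 : ∀ {k γr} → Connected G → 2 ≤ n → 1 ≤ k → IsResDomNum G k γr → γr ≤ n ∸ 1
  resDomNum≤n∸1 {γr = γr} connected (s≤s (s≤s _)) 1≤k (_ , minR)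
    with _ , 0~y ← Walk⇒neighbour (proj₂ (connected zero (suc zero))) (λ ())
    = subst (γr ≤_) (∣∁⁅x⁆∣≡n∸1 zero)
        (minR (∁ ⁅ zero ⁆) (∁⁅x⁆-resolving zero , ∁⁅x⁆-dominating 1≤k 0~y))

proposition2p1 : ∀ (n : ℕ) → (G : Graph n) → Connected G → 2 ≤ n →
    ∀ (k : ℕ) → 1 ≤ k →
    ∀ (γk d γr : ℕ) → IsDomNum G k γk → IsMetricDim G d → IsResDomNum G k γr →
    (γk ⊔ d ≤ γr) × (γr ≤ (γk + d) ⊓ (n ∸ 1))
proposition2p1 n G connected 2≤n k 1≤k γk d γr isγk isDim isγr =
  ⊔-lub (IsMinCard-mono proj₂ isγk isγr) (IsMinCard-mono proj₁ isDim isγr) ,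
  ⊓-glb (resDomNum≤domNum+metricDim G isγk isDim isγr) (resDomNum≤n∸1 G connected 2≤n 1≤k isγr)
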